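{- For every $h,n\ge 2$, the trivial subgroup $1=\{(id,id)\}$ of $S_h\times S_n$ belongs to $\mathrm{SPFAG}_h(n)$, to $\mathrm{SPFNG}_h(n)$ and to $\mathrm{SPFSG}_h(n)$.
   Context: Let $G=S_h\times S_n$, $\mathcal P=(S_n)^h$, with $G$ acting on $\mathcal P$: $p^{(\varphi,\psi)}$ has $i$-th component $\psi\,p_{\varphi^{ -1}(i)}$ (products are compositions). An SPF is a map $F:\mathcal P\to S_n$. Its symmetry group is $G(F)=\{(\varphi,\psi)\in G: F(p^{(\varphi,\psi)})=\psi F(p)\ \forall p\}$; its anonymity group $G_1(F)=G(F)\cap(S_h\times\{id\})$; its neutrality group $G_2(F)=G(F)\cap(\{id\}\times S_n)$. $\mathrm{SPFAG}_h(n)$, $\mathrm{SPFNG}_h(n)$, $\mathrm{SPFSG}_h(n)$ denote the sets $\{G_1(F)\}$, $\{G_2(F)\}$, $\{G(F)\}$ as $F$ ranges over all SPFs $\mathcal P\to S_n$. -}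

module Defs where

open import Data.Nat using (ℕ)
open import Data.Fin using (Fin)
open import Data.Fin.Permutation using (Permutation′; _⟨$⟩ʳ_; _⟨$⟩ˡ_; _∘ₚ_; _≈_; id)
open import Data.Product using (_×_; Σ)
open import Function.Bundles using (_⇔_)

Profile : ℕ → ℕ → Set
Profile h n = Fin h → Permutation′ n

SPF : ℕ → ℕ → Set
SPF h n = Profile h n → Permutation′ n

-- The action of (φ , ψ) ∈ S_h × S_n on profiles:
-- (p^(φ,ψ))_i = ψ ∘ p_{φ⁻¹(i)}.
-- Note: stdlib's  π₁ ∘ₚ π₂  applies π₁ first, then π₂, so  ψ ∘ q  is  q ∘ₚ ψ.
act : ∀ {h n} → Profile h n → Permutation′ h → Permutation′ n → Profile h n
act p φ ψ i = p (φ ⟨$⟩ˡ i) ∘ₚ ψ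

InG : ∀ {h n} → SPF h n → Permutation′ h → Permutation′ n → Set
InG F φ ψ = ∀ p → F (act p φ ψ) ≈ (F p ∘ₚ ψ)

InG₁ : ∀ {h n} → SPF h n → Permutation′ h → Permutation′ n → Set
InG₁ F φ ψ = InG F φ ψ × ψ ≈ id

InG₂ : ∀ {h n} → SPF h n → Permutation′ h → Permutation′ n → Set
InG₂ F φ ψ = InG F φ ψ × φ ≈ id

IsTrivial : ∀ {h n} → (Permutation′ h → Permutation′ n → Set) → Set
IsTrivial {h} {n} U = ∀ (φ : Permutation′ h) (ψ : Permutation′ n) → U φ ψ ⇔ (φ ≈ id × ψ ≈ id)

TrivialInSPFAG TrivialInSPFNG TrivialInSPFSG : ℕ → ℕ → Set
TrivialInSPFAG h n = Σ (SPF h n) λ F → IsTrivial (InG₁ F)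
TrivialInSPFNG h n = Σ (SPF h n) λ F → IsTrivial (InG₂ F)
TrivialInSPFSG h n = Σ (SPF h n) λ F → IsTrivial (InG F)

-- Let F be the identity when the voters whose ranking fixes alternative 0 form
-- an initial segment of voters, and the transposition (0 1) otherwise. A
-- symmetry (φ , ψ) of F fixes the value of F on unanimous profiles, which
-- forces ψ = id. Then F p = F (p ∘ φ⁻¹) for every profile, so reindexing by
-- φ⁻¹ preserves initial segments; a permutation of a finite chain that does so
-- is monotone, hence the identity. The anonymity and neutrality groups of F,
-- being subgroups of its trivial symmetry group, are trivial as well.
module Submission where

open import Defs
open import Data.Nat using (ℕ; _≤_; suc; z≤n; s≤s)
open import Data.Product using (_×_)

open import Data.Bool using (Bool; true; false; T; if_then_else_)
open import Data.Fin as Fin using (Fin; toℕ; inject₁)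
open import Data.Fin.Induction using (<-weakInduction)
open import Data.Fin.Patterns using (0F; 1F)
open import Data.Fin.Permutation using (Permutation′; _⟨$⟩ʳ_; _⟨$⟩ˡ_; _∘ₚ_; _≈_; id; flip; transpose; inverseˡ; inverseʳ)
open import Data.Fin.Properties using (_≟_; _≤?_; all?; ≤∧≢⇒<; <⇒≢; ≤-antisym; ≤̄⇒inject₁<; toℕ-inject₁)
import Data.Nat.Properties as ℕ
open import Data.Product using (_,_; uncurry)
open import Function using (_∘_; Injective; Injection)
open import Function.Bundles using (mk⇔)
open import Function.Properties.Inverse using (↔⇒↣)
open import Relation.Binary.Definitions using (Monotonic₁)
open import Relation.Binary.PropositionalEquality using (_≡_; _≗_; refl; sym; trans; cong; subst; subst₂; module ≡-Reasoning)
open import Relation.Nullary using (Dec; yes; no; does; contradiction)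
open import Relation.Nullary.Decidable using (T?; _→-dec_; isYes; toWitness; fromWitness)

DownClosed : ∀ {h} → (Fin h → Bool) → Set
DownClosed b = ∀ i j → i Fin.≤ j → T (b j) → T (b i)

downClosed? : ∀ {h} (b : Fin h → Bool) → Dec (DownClosed b)
downClosed? b = all? λ i → all? λ j → i ≤? j →-dec T? (b j) →-dec T? (b i)

downClosed-resp : ∀ {h} {b c : Fin h → Bool} → b ≗ c → DownClosed b → DownClosed c
downClosed-resp b≗c down i j i≤j cj =
  subst T (b≗c i) (down i j i≤j (subst T (sym (b≗c j)) cj))

atMost : ∀ {h} → Fin h → Fin h → Bool
atMost t x = isYes (x ≤? t)

atMost-downClosed : ∀ {h} (t : Fin h) → DownClosed (atMost t)
atMost-downClosed t i j i≤j j≤t = fromWitness (ℕ.≤-trans i≤j (toWitness j≤t))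

preserves-downClosed⇒monotone : ∀ {m n} {σ : Fin m → Fin n} →
  (∀ b → DownClosed b → DownClosed (b ∘ σ)) → Monotonic₁ Fin._≤_ Fin._≤_ σ
preserves-downClosed⇒monotone {σ = σ} pres {i} {j} i≤j =
  toWitness (pres (atMost (σ j)) (atMost-downClosed (σ j)) i j i≤j (fromWitness ℕ.≤-refl))

monotone∧injective⇒strictlyMonotone : ∀ {m n} {σ : Fin m → Fin n} →
  Monotonic₁ Fin._≤_ Fin._≤_ σ → Injective _≡_ _≡_ σ → Monotonic₁ Fin._<_ Fin._<_ σ
monotone∧injective⇒strictlyMonotone mono inj i<j =
  ≤∧≢⇒< (mono (ℕ.<⇒≤ i<j)) (<⇒≢ i<j ∘ inj)

strictlyMonotone⇒rightInverse-monotone : ∀ {m n} {σ : Fin m → Fin n} {σ⁻¹ : Fin n → Fin m} →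
  Monotonic₁ Fin._<_ Fin._<_ σ → (∀ x → σ (σ⁻¹ x) ≡ x) → Monotonic₁ Fin._≤_ Fin._≤_ σ⁻¹
strictlyMonotone⇒rightInverse-monotone strict inverse {i} {j} i≤j =
  ℕ.≮⇒≥ λ σ⁻¹j<σ⁻¹i → ℕ.≤⇒≯ i≤j (subst₂ Fin._<_ (inverse j) (inverse i) (strict σ⁻¹j<σ⁻¹i))

strictlyMonotone⇒inflationary : ∀ {h} {σ : Fin h → Fin h} →
  Monotonic₁ Fin._<_ Fin._<_ σ → ∀ j → j Fin.≤ σ j
strictlyMonotone⇒inflationary {suc _} {σ} strict = <-weakInduction (λ j → j Fin.≤ σ j) z≤n step
  where
  step : ∀ i → inject₁ i Fin.≤ σ (inject₁ i) → Fin.suc i Fin.≤ σ (Fin.suc i)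
  step i ih = subst (λ k → suc k ≤ toℕ (σ (Fin.suc i))) (toℕ-inject₁ i)
                (ℕ.≤-<-trans ih (strict (≤̄⇒inject₁< ℕ.≤-refl)))

monotone⇒≈id : ∀ {h} (φ : Permutation′ h) → Monotonic₁ Fin._≤_ Fin._≤_ (φ ⟨$⟩ʳ_) → φ ≈ id
monotone⇒≈id φ mono j = ≤-antisym φj≤j (strictlyMonotone⇒inflationary strict j)
  where
  strict : Monotonic₁ Fin._<_ Fin._<_ (φ ⟨$⟩ʳ_)
  strict = monotone∧injective⇒strictlyMonotone mono (Injection.injective (↔⇒↣ φ))

  strict⁻¹ : Monotonic₁ Fin._<_ Fin._<_ (φ ⟨$⟩ˡ_)
  strict⁻¹ = monotone∧injective⇒strictlyMonotone
               (strictlyMonotone⇒rightInverse-monotone strict (λ _ → inverseʳ φ))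
               (Injection.injective (↔⇒↣ (flip φ)))

  φj≤j : φ ⟨$⟩ʳ j Fin.≤ j
  φj≤j = subst (φ ⟨$⟩ʳ j Fin.≤_) (inverseˡ φ) (strictlyMonotone⇒inflationary strict⁻¹ (φ ⟨$⟩ʳ j))

flip-≈id : ∀ {h} (φ : Permutation′ h) → φ ≈ id → flip φ ≈ id
flip-≈id φ φ≈id i = trans (cong (φ ⟨$⟩ˡ_) (sym (φ≈id i))) (inverseˡ φ)

module InitialSegmentRule (h m : ℕ) where

  swap01 : Permutation′ (suc (suc m))
  swap01 = transpose 0F 1F

  select : ∀ {A : Set} → Dec A → Permutation′ (suc (suc m))
  select (yes _) = id
  select (no _)  = swap01

  select-yes : ∀ {A : Set} (a? : Dec A) → A → select a? ≡ id
  select-yes (yes _) _ = refl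
  select-yes (no ¬a) a = contradiction a ¬a

  select-fixes-0 : ∀ {A : Set} (a? : Dec A) → select a? ⟨$⟩ʳ 0F ≡ 0F → A
  select-fixes-0 (yes a) _ = a
  select-fixes-0 (no _) ()

  select-cong : ∀ {A B : Set} → (A → B) → (B → A) → (a? : Dec A) (b? : Dec B) → select a? ≡ select b?
  select-cong _   _   (yes _) (yes _) = refl
  select-cong _   _   (no _)  (no _)  = refl
  select-cong A→B _   (yes a) (no ¬b) = contradiction (A→B a) ¬b
  select-cong _   B→A (no ¬a) (yes b) = contradiction (B→A b) ¬a

  supporters : Profile h (suc (suc m)) → Fin h → Bool
  supporters p i = does (p i ⟨$⟩ʳ 0F ≟ 0F)

  F : SPF h (suc (suc m))
  F p = select (downClosed? (supporters p))

  F-downClosed : ∀ p → DownClosed (supporters p) → F p ≡ id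
  F-downClosed p = select-yes (downClosed? (supporters p))

  F-fixes-0 : ∀ p → F p ⟨$⟩ʳ 0F ≡ 0F → DownClosed (supporters p)
  F-fixes-0 p = select-fixes-0 (downClosed? (supporters p))

  F-cong : ∀ p q → supporters p ≗ supporters q → F p ≡ F q
  F-cong p q p≗q = select-cong (downClosed-resp p≗q) (downClosed-resp (sym ∘ p≗q))
                     (downClosed? (supporters p)) (downClosed? (supporters q))

  profile : (Fin h → Bool) → Profile h (suc (suc m))
  profile b i = if b i then id else swap01

  supporters-profile : ∀ b → supporters (profile b) ≗ b
  supporters-profile b i with b i
  ... | true  = refl
  ... | false = refl

  supporters-act : ∀ p φ ψ → ψ ≈ id → supporters (act p φ ψ) ≗ supporters p ∘ (φ ⟨$⟩ˡ_)
  supporters-act p φ ψ ψ≈id i = cong (λ k → does (k ≟ 0F)) (ψ≈id _)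

  module _ (φ : Permutation′ h) (ψ : Permutation′ (suc (suc m))) (g : InG F φ ψ) where

    InG⇒ψ≈id : ψ ≈ id
    InG⇒ψ≈id x = begin
      ψ ⟨$⟩ʳ x                    ≡⟨ cong (λ π → (π ∘ₚ ψ) ⟨$⟩ʳ x) (sym (F-unanimous id)) ⟩
      (F (λ _ → id) ∘ₚ ψ) ⟨$⟩ʳ x  ≡⟨ sym (g (λ _ → id) x) ⟩
      F (λ _ → ψ) ⟨$⟩ʳ x          ≡⟨ cong (_⟨$⟩ʳ x) (F-unanimous ψ) ⟩
      x                           ∎
      where
      open ≡-Reasoning
      F-unanimous : ∀ π → F (λ _ → π) ≡ id
      F-unanimous π = F-downClosed (λ _ → π) λ _ _ _ t → t

    InG⇒preserves-downClosed : ∀ b → DownClosed b → DownClosed (b ∘ (φ ⟨$⟩ˡ_))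
    InG⇒preserves-downClosed b down =
      downClosed-resp (λ i → trans (supporters-act p φ ψ InG⇒ψ≈id i) (supporters-profile b _))
        (F-fixes-0 (act p φ ψ) Fp′0≡0)
      where
      open ≡-Reasoning
      p = profile b
      Fp′0≡0 : F (act p φ ψ) ⟨$⟩ʳ 0F ≡ 0F
      Fp′0≡0 = begin
        F (act p φ ψ) ⟨$⟩ʳ 0F   ≡⟨ g p 0F ⟩
        ψ ⟨$⟩ʳ (F p ⟨$⟩ʳ 0F)    ≡⟨ cong (λ π → ψ ⟨$⟩ʳ (π ⟨$⟩ʳ 0F)) (F-downClosed p
                                     (downClosed-resp (sym ∘ supporters-profile b) down)) ⟩
        ψ ⟨$⟩ʳ 0F               ≡⟨ InG⇒ψ≈id 0F ⟩
        0F                      ∎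

    -- flip (flip φ) applies as φ, so this is φ ≈ id.
    InG⇒φ≈id : φ ≈ id
    InG⇒φ≈id = flip-≈id (flip φ)
      (monotone⇒≈id (flip φ) (preserves-downClosed⇒monotone InG⇒preserves-downClosed))

  ≈id⇒InG : ∀ φ ψ → φ ≈ id → ψ ≈ id → InG F φ ψ
  ≈id⇒InG φ ψ φ≈id ψ≈id p x = begin
    F (act p φ ψ) ⟨$⟩ʳ x   ≡⟨ cong (_⟨$⟩ʳ x) (F-cong (act p φ ψ) p λ i →
                                trans (supporters-act p φ ψ ψ≈id i) (cong (supporters p) (flip-≈id φ φ≈id i))) ⟩
    F p ⟨$⟩ʳ x             ≡⟨ sym (ψ≈id _) ⟩
    ψ ⟨$⟩ʳ (F p ⟨$⟩ʳ x)    ∎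
    where open ≡-Reasoning

  G-trivial : IsTrivial (InG F)
  G-trivial φ ψ = mk⇔ (λ g → InG⇒φ≈id φ ψ g , InG⇒ψ≈id φ ψ g) (uncurry (≈id⇒InG φ ψ))

  G₁-trivial : IsTrivial (InG₁ F)
  G₁-trivial φ ψ = mk⇔ (λ (g , _) → InG⇒φ≈id φ ψ g , InG⇒ψ≈id φ ψ g) λ (φ≈id , ψ≈id) → ≈id⇒InG φ ψ φ≈id ψ≈id , ψ≈id

  G₂-trivial : IsTrivial (InG₂ F)
  G₂-trivial φ ψ = mk⇔ (λ (g , _) → InG⇒φ≈id φ ψ g , InG⇒ψ≈id φ ψ g) λ (φ≈id , ψ≈id) → ≈id⇒InG φ ψ φ≈id ψ≈id , φ≈id

-- The construction works for every h.
proposition29 : ∀ (h n : ℕ) → 2 ≤ h → 2 ≤ n → TrivialInSPFAG h n × TrivialInSPFNG h n × TrivialInSPFSG h n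
proposition29 h (suc (suc m)) _ (s≤s (s≤s z≤n)) = (F , G₁-trivial) , (F , G₂-trivial) , (F , G-trivial)
  where open InitialSegmentRule h m
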